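{- Let $n>1$ and $0<t\le n$. Let $R$ be a randomized $t$-query algorithm on $n$ input bits with Boolean output, and let $K\subseteq\{0,1\}^n$ be a set with $|K|>2^{n-1}$ such that $\Pr[R(y)=\mathrm{PAR}(y)]\ge 2/3$ for every $y\in K$, where $\mathrm{PAR}(y)=y_1\oplus\cdots\oplus y_n$. Then there exists a Bob-strategy $\mathrm{STRAT}_B$ such that, if $(\pi,z)$ is drawn uniformly from $S_n\times\{0,1\}$ and $\mathbf{b}=b(\pi,z)$ (defined with respect to $\mathrm{STRAT}_B$), then \[\Pr_{\pi,z,R}[R \text{ is search-successful on } \mathbf{b}] \ \ge\ 1/3.\]
   Context: Let $S_n$ be the set of permutations $\pi=(\pi(1),\dots,\pi(n))$ of $[n]$. A Bob-strategy $\mathrm{STRAT}_B$ is a family of functions $F_t: S_n \to \{0,1\}$, $t=1,\dots,n-1$, where each $F_t$ is $t$-restricted, i.e. $F_t(\pi)$ depends only on $\pi(1),\dots,\pi(t)$. For such a strategy, $\pi\in S_n$ and $z\in\{0,1\}$, define $b(\pi,z)\in\{0,1\}^n$ by $b_j = F_t(\pi)$ if $j=\pi(t)$ for some $t<n$, and $b_j = z$ if $j=\pi(n)$. A randomized $t$-query algorithm $R$ is a probability distribution over depth-$t$ decision trees $R_r$ on input variables $b_1,\dots,b_n$ (each with Boolean output). For an execution of $R$ on $b(\pi,z)$ with random choice $r$, let $\mathrm{VISITS}\subseteq[n]$ be the set of coordinates queried by $R_r$; the execution is search-successful if $\pi(n)\in\mathrm{VISITS}$.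
   Formalization: The randomized $t$-query algorithm $R$ assigns rational probabilities to its depth-$t$ decision trees. -}

module Defs where

open import Data.Bool using (Bool; true; false; if_then_else_; _xor_)
  renaming (_≟_ to _≟ᵇ_)
open import Data.Nat as ℕ using (ℕ; zero; suc; s≤s; z≤n; _<?_)
open import Data.Fin using (Fin; toℕ) renaming (_≟_ to _≟ᶠ_)
open import Data.Vec using (Vec; []; _∷_; lookup; toList; foldr)
open import Data.List using (List; []; _∷_; concatMap; map; length; allFin; mapMaybe; last)
open import Data.List.Membership.Propositional using (_∈_)
open import Data.List.Relation.Unary.Unique.Propositional using (Unique)
import Data.List.Relation.Unary.Unique.DecPropositional as UD
import Data.List.Membership.DecPropositional as MD
open import Data.Maybe using (Maybe; just; nothing; maybe)
open import Data.Product using (Σ; _×_; _,_; proj₁; proj₂)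
open import Data.Integer using (+_)
open import Data.Rational using (ℚ; 0ℚ; 1ℚ; _+_; _*_; _/_)
import Data.Rational as Q
open import Relation.Nullary using (yes; no; does)
open import Relation.Binary.PropositionalEquality using (_≡_)

-- Bit strings and parity.  Coordinates are 0-indexed: coordinate j of
-- the paper is Fin index (j-1).

Input : ℕ → Set
Input n = Vec Bool n

PAR : ∀ {n} → Input n → Bool
PAR = foldr _ _xor_ false

data DT (n : ℕ) : ℕ → Set where
  leaf  : ∀ {d} → Bool → DT n d
  query : ∀ {d} → Fin n → (ifFalse ifTrue : DT n d) → DT n (suc d)

eval : ∀ {n d} → DT n d → (Fin n → Bool) → Bool
eval (leaf o)      b = o
eval (query j f t) b = if b j then eval t b else eval f b

visits : ∀ {n d} → DT n d → (Fin n → Bool) → List (Fin n)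
visits (leaf o)      b = []
visits (query j f t) b = j ∷ (if b j then visits t b else visits f b)

Σℚ : ∀ {A : Set} → List A → (A → ℚ) → ℚ
Σℚ []       f = 0ℚ
Σℚ (x ∷ xs) f = f x + Σℚ xs f

ind : Bool → ℚ
ind true  = 1ℚ
ind false = 0ℚ

ℕtoℚ : ℕ → ℚ
ℕtoℚ m = (+ m) / 1

-- Randomized t-query algorithms: finite probability distributions
-- (rational weights) over depth-t decision trees on n variables.

record RandAlg (n t : ℕ) : Set where
  field
    support : List (ℚ × DT n t)
    nonneg  : ∀ {p} → p ∈ support → 0ℚ Q.≤ proj₁ p
    total   : Σℚ support proj₁ ≡ 1ℚ
open RandAlg public

PrCorrect : ∀ {n t} → RandAlg n t → Input n → ℚ
PrCorrect R y =
  Σℚ (support R) (λ p → proj₁ p * ind (does (eval (proj₂ p) (lookup y) ≟ᵇ PAR y)))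

-- Permutations of [n]:  π(i+1) = lookup (proj₁ π) i, a duplicate-free
-- vector of length n over Fin n.

Perm : ℕ → Set
Perm n = Σ (Vec (Fin n) n) (λ v → Unique (toList v))

allVecs : ∀ {A : Set} → List A → (m : ℕ) → List (Vec A m)
allVecs xs zero    = [] ∷ []
allVecs xs (suc m) = concatMap (λ x → map (x ∷_) (allVecs xs m)) xs

asPerm : ∀ {n} → Vec (Fin n) n → Maybe (Perm n)
asPerm v with UD.unique? _≟ᶠ_ (toList v)
... | yes u = just (v , u)
... | no  _ = nothing

allPerms : (n : ℕ) → List (Perm n)
allPerms n = mapMaybe asPerm (allVecs (allFin n) n)

piLast : ∀ {n} → Perm n → Maybe (Fin n)
piLast π = last (toList (proj₁ π))

record Strategy (n : ℕ) : Set where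
  field
    F : (t : ℕ) → 1 ℕ.≤ t → t ℕ.< n → Perm n → Bool
    restricted : ∀ t (p : 1 ℕ.≤ t) (q : t ℕ.< n) (π σ : Perm n) →
      (∀ (i : Fin n) → toℕ i ℕ.< t → lookup (proj₁ π) i ≡ lookup (proj₁ σ) i) →
      F t p q π ≡ F t p q σ
open Strategy public

-- position i (0-indexed; paper position t = i+1) of j in π
findPos : ∀ {n m} → Vec (Fin n) m → Fin n → Maybe (Fin m)
findPos []       j = nothing
findPos (x ∷ xs) j with x ≟ᶠ j
... | yes _ = just Fin.zero
  where import Data.Fin as Fin
... | no  _ = maybe (λ i → just (Data.Fin.suc i)) nothing (findPos xs j)

-- the bit b_j with j = π(i+1): F_{i+1}(π) if i+1 < n, and z if i+1 = n
bAtPos : ∀ {n} → Strategy n → Perm n → Bool → Fin n → Bool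
bAtPos {n} S π z i with suc (toℕ i) <? n
... | yes lt = F S (suc (toℕ i)) (s≤s z≤n) lt π
... | no  _  = z

bvec : ∀ {n} → Strategy n → Perm n → Bool → Fin n → Bool
bvec S π z j = maybe (bAtPos S π z) false (findPos (proj₁ π) j)

searchSuccessful : ∀ {n d} → Strategy n → Perm n → Bool → DT n d → Bool
searchSuccessful S π z T =
  maybe (λ l → does (MD._∈?_ _≟ᶠ_ l (visits T (bvec S π z)))) false (piLast π)

-- Σ_{π ∈ S_n} Σ_{z ∈ {0,1}} Σ_r Pr[r] · [search-successful]
-- i.e.  (2 · n!) · Pr_{π,z,R}[R is search-successful on b(π,z)]
successMass : ∀ {n t} → Strategy n → RandAlg n t → ℚ
successMass {n} S R =
  Σℚ (allPerms n) (λ π →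
    Σℚ (false ∷ true ∷ []) (λ z →
      Σℚ (support R) (λ p → proj₁ p * ind (searchSuccessful S π z (proj₂ p)))))

module Submission where

-- Bob answers each revealed coordinate with the majority value among the members of K that
-- are consistent with his earlier answers.  Each answer keeps at least half of them, so as
-- |K| > 2^(n-1), more than one member survives the first n-1 answers; survivors can differ
-- only at π(n), so both completions b(π,0) and b(π,1) lie in K.  Their parities differ, so a
-- tree that does not query π(n) gives the same output on both and is correct on at most one.
-- With cᶻ, sᶻ the indicators of correctness and search success on b(π,z) this gives
-- 2(c₀ + c₁) ≤ 2 + s₀ + s₁ pointwise, and averaging over R with Pr[cᶻ] ≥ 2/3 yields
-- Pr[s₀] + Pr[s₁] ≥ 2/3 for every π.

open import Defs
open import Data.Nat using (ℕ; _<_; _≤_; _^_; _∸_)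
open import Data.List using (List; length)
open import Data.List.Membership.Propositional using (_∈_)
open import Data.List.Relation.Unary.Unique.Propositional using (Unique)
open import Data.Integer using (+_)
open import Data.Rational using (_/_; _*_)
import Data.Rational as Q
open import Data.Product using (Σ)

open import Data.Bool using (Bool; true; false; not; _∧_; _xor_; if_then_else_) renaming (_≟_ to _≟ᵇ_)
open import Data.Bool.Properties using (not-distribˡ-xor; not-distribʳ-xor)
open import Data.Nat using (zero; suc; s≤s; z≤n; _<?_)
import Data.Nat as ℕ
import Data.Nat.Properties as ℕ
import Data.Nat.Coprimality as Coprime
import Data.Integer.Properties as ℤ
open import Data.Rational using (ℚ; mkℚ; 0ℚ; 1ℚ; _+_; -_; nonNegative)
open import Data.Rational.Properties
  using (↥p/↧p≡p; ≤-refl; ≤-reflexive; ≤-trans; +-mono-≤; +-monoʳ-≤; +-assoc; +-identityˡ; +-identityʳ;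
         +-inverseˡ; *-zeroʳ; *-identityʳ; *-distribˡ-+; *-monoˡ-≤-nonNeg; module ≤-Reasoning)
open import Data.Rational.Solver using (module +-*-Solver)
open import Data.Fin using (Fin; toℕ; fromℕ; punchOut) renaming (zero to 0F; suc to sucF; _≟_ to _≟ᶠ_)
import Data.Fin.Properties as Fin
open import Data.Vec using (Vec; []; _∷_; lookup; toList; tabulate)
open import Data.Vec.Properties using (lookup∘tabulate)
open import Data.Vec.Relation.Unary.All.Properties using (toList⁻; lookup⁺)
open import Data.Vec.Relation.Binary.Pointwise.Extensional using (ext; Pointwise-≡⇒≡)
open import Data.List using ([]; _∷_; last; filter)
open import Data.List.Membership.Propositional using (_∉_)
import Data.List.Membership.DecPropositional as DecMembership
open import Data.List.Membership.Propositional.Properties using (∈-filter⁻)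
open import Data.List.Relation.Binary.Subset.Propositional using (_⊆_)
open import Data.List.Relation.Unary.Any using (here; there)
open import Data.List.Relation.Unary.All using (_∷_)
open import Data.List.Relation.Unary.AllPairs using (_∷_)
import Data.List.Relation.Unary.Unique.Propositional.Properties as Unique
open import Data.Maybe using (just)
open import Data.Product using (∃; _×_; _,_; proj₁; proj₂)
open import Data.Sum using (inj₁; inj₂)
open import Data.Empty using (⊥-elim)
open import Function using (_$_; _∘_)
open import Function.Definitions using (Injective)
open import Relation.Nullary using (yes; no; ¬_; does; contradiction)
open import Relation.Nullary.Reflects using (ofʸ; ofⁿ)
open import Relation.Nullary.Decidable using (from-yes)
open import Relation.Binary.PropositionalEquality

⅓ ⅔ : ℚ
⅓ = + 1 / 3
⅔ = + 2 / 3

ℕtoℚ≡mkℚ : ∀ k → ℕtoℚ k ≡ mkℚ (+ k) 0 (Coprime.sym (Coprime.1-coprimeTo k))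
ℕtoℚ≡mkℚ k = ↥p/↧p≡p _

ℕtoℚ-+ : ∀ m n → ℕtoℚ (m ℕ.+ n) ≡ ℕtoℚ m + ℕtoℚ n
ℕtoℚ-+ m n rewrite ℕtoℚ≡mkℚ m | ℕtoℚ≡mkℚ n
                 | ℤ.*-identityʳ (+ m) | ℤ.*-identityʳ (+ n) = refl

+-cancelˡ-≤ : ∀ r {p q} → r + p Q.≤ r + q → p Q.≤ q
+-cancelˡ-≤ r {p} {q} r+p≤r+q = subst₂ Q._≤_ (cancel p) (cancel q) (+-monoʳ-≤ (- r) r+p≤r+q)
  where
  cancel : ∀ x → - r + (r + x) ≡ x
  cancel x = trans (sym (+-assoc (- r) r x)) (trans (cong (_+ x) (+-inverseˡ r)) (+-identityˡ x))

module _ {A : Set} where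

  Σℚ-cong : ∀ (xs : List A) {f g : A → ℚ} → (∀ x → f x ≡ g x) → Σℚ xs f ≡ Σℚ xs g
  Σℚ-cong []       f≗g = refl
  Σℚ-cong (x ∷ xs) f≗g = cong₂ _+_ (f≗g x) (Σℚ-cong xs f≗g)

  Σℚ-+ : ∀ (xs : List A) (f g : A → ℚ) → Σℚ xs (λ x → f x + g x) ≡ Σℚ xs f + Σℚ xs g
  Σℚ-+ []       f g = refl
  Σℚ-+ (x ∷ xs) f g rewrite Σℚ-+ xs f g =
    solve 4 (λ a b c d → (a :+ b) :+ (c :+ d) := (a :+ c) :+ (b :+ d)) refl
      (f x) (g x) (Σℚ xs f) (Σℚ xs g)
    where open +-*-Solver

  Σℚ-mono : ∀ (xs : List A) {f g : A → ℚ} → (∀ x → x ∈ xs → f x Q.≤ g x) → Σℚ xs f Q.≤ Σℚ xs g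
  Σℚ-mono []       f≤g = ≤-refl
  Σℚ-mono (x ∷ xs) f≤g = +-mono-≤ (f≤g x (here refl)) (Σℚ-mono xs (λ y y∈ → f≤g y (there y∈)))

  *-length≤Σℚ : ∀ (xs : List A) q {f : A → ℚ} → (∀ x → q Q.≤ f x) → q * ℕtoℚ (length xs) Q.≤ Σℚ xs f
  *-length≤Σℚ []       q q≤f = ≤-reflexive (*-zeroʳ q)
  *-length≤Σℚ (x ∷ xs) q {f} q≤f = begin
    q * ℕtoℚ (suc (length xs))     ≡⟨ cong (q *_) (ℕtoℚ-+ 1 (length xs)) ⟩
    q * (1ℚ + ℕtoℚ (length xs))    ≡⟨ *-distribˡ-+ q 1ℚ _ ⟩
    q * 1ℚ + q * ℕtoℚ (length xs)  ≡⟨ cong (_+ q * ℕtoℚ (length xs)) (*-identityʳ q) ⟩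
    q + q * ℕtoℚ (length xs)       ≤⟨ +-mono-≤ (q≤f x) (*-length≤Σℚ xs q q≤f) ⟩
    Σℚ (x ∷ xs) f                  ∎
    where open ≤-Reasoning

module _ {A : Set} where

  E : List (ℚ × A) → (A → ℚ) → ℚ
  E ws f = Σℚ ws (λ p → proj₁ p * f (proj₂ p))

  Pr : List (ℚ × A) → (A → Bool) → ℚ
  Pr ws P = E ws (λ a → ind (P a))

  E-+ : ∀ ws (f g : A → ℚ) → E ws (λ a → f a + g a) ≡ E ws f + E ws g
  E-+ ws f g = trans (Σℚ-cong ws (λ p → *-distribˡ-+ (proj₁ p) _ _)) (Σℚ-+ ws _ _)

  E-1 : ∀ ws → Σℚ ws proj₁ ≡ 1ℚ → E ws (λ _ → 1ℚ) ≡ 1ℚ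
  E-1 ws total = trans (Σℚ-cong ws (λ p → *-identityʳ (proj₁ p))) total

  E-mono : ∀ ws {f g : A → ℚ} → (∀ {p} → p ∈ ws → 0ℚ Q.≤ proj₁ p) → (∀ a → f a Q.≤ g a) →
           E ws f Q.≤ E ws g
  E-mono ws nonneg f≤g = Σℚ-mono ws (λ p p∈ →
    *-monoˡ-≤-nonNeg (proj₁ p) {{nonNegative (nonneg p∈)}} (f≤g (proj₂ p)))

ind-nonNeg : ∀ b → 0ℚ Q.≤ ind b
ind-nonNeg false = ≤-refl
ind-nonNeg true  = from-yes (0ℚ Q.≤? 1ℚ)

2≤2+ind : ∀ s₀ s₁ → 1ℚ + 1ℚ Q.≤ (1ℚ + 1ℚ) + (ind s₀ + ind s₁)
2≤2+ind s₀ s₁ = +-monoʳ-≤ (1ℚ + 1ℚ) (+-mono-≤ (ind-nonNeg s₀) (ind-nonNeg s₁))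

ind-∧-bound : ∀ c₀ c₁ s₀ s₁ → (c₀ ∧ c₁ ≡ true → s₀ ∧ s₁ ≡ true) →
  (ind c₀ + ind c₁) + (ind c₀ + ind c₁) Q.≤ (1ℚ + 1ℚ) + (ind s₀ + ind s₁)
ind-∧-bound true  true  true  true  _ = ≤-refl
ind-∧-bound true  true  false _     h with h refl
... | ()
ind-∧-bound true  true  true  false h with h refl
... | ()
ind-∧-bound false false s₀    s₁    _ = ≤-trans (from-yes (0ℚ Q.≤? 1ℚ + 1ℚ)) (2≤2+ind s₀ s₁)
ind-∧-bound false true  s₀    s₁    _ = 2≤2+ind s₀ s₁
ind-∧-bound true  false s₀    s₁    _ = 2≤2+ind s₀ s₁

Pr-forced-≥-⅔ : ∀ {n t} (R : RandAlg n t) (c₀ c₁ s₀ s₁ : DT n t → Bool) →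
  (∀ T → c₀ T ∧ c₁ T ≡ true → s₀ T ∧ s₁ T ≡ true) →
  ⅔ Q.≤ Pr (support R) c₀ → ⅔ Q.≤ Pr (support R) c₁ → ⅔ Q.≤ Pr (support R) s₀ + Pr (support R) s₁
Pr-forced-≥-⅔ R c₀ c₁ s₀ s₁ forces h₀ h₁ = +-cancelˡ-≤ (1ℚ + 1ℚ) $ begin
  (1ℚ + 1ℚ) + ⅔                                    ≡⟨⟩
  (⅔ + ⅔) + (⅔ + ⅔)                                ≤⟨ +-mono-≤ (+-mono-≤ h₀ h₁) (+-mono-≤ h₀ h₁) ⟩
  (Pr ws c₀ + Pr ws c₁) + (Pr ws c₀ + Pr ws c₁)    ≡⟨ sym (E-double-sum (ind ∘ c₀) (ind ∘ c₁)) ⟩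
  E ws (λ T → (ind (c₀ T) + ind (c₁ T)) + (ind (c₀ T) + ind (c₁ T)))
      ≤⟨ E-mono ws (nonneg R) (λ T → ind-∧-bound (c₀ T) (c₁ T) (s₀ T) (s₁ T) (forces T)) ⟩
  E ws (λ T → (1ℚ + 1ℚ) + (ind (s₀ T) + ind (s₁ T)))
      ≡⟨ E-+ ws (λ _ → 1ℚ + 1ℚ) (λ T → ind (s₀ T) + ind (s₁ T)) ⟩
  E ws (λ _ → 1ℚ + 1ℚ) + E ws (λ T → ind (s₀ T) + ind (s₁ T))
      ≡⟨ cong₂ _+_ (trans (E-+ ws _ _) (cong₂ _+_ one one)) (E-+ ws _ _) ⟩
  (1ℚ + 1ℚ) + (Pr ws s₀ + Pr ws s₁)                ∎
  where
  open ≤-Reasoning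
  ws = support R
  one : E ws (λ _ → 1ℚ) ≡ 1ℚ
  one = E-1 ws (total R)
  E-double-sum : ∀ f g → E ws (λ T → (f T + g T) + (f T + g T)) ≡ (E ws f + E ws g) + (E ws f + E ws g)
  E-double-sum f g = trans (E-+ ws _ _) (cong₂ _+_ (E-+ ws f g) (E-+ ws f g))

vec-ext : ∀ {A : Set} {n} {x y : Vec A n} → (∀ j → lookup x j ≡ lookup y j) → x ≡ y
vec-ext x≗y = Pointwise-≡⇒≡ (ext x≗y)

PAR-flip : ∀ {n} (x y : Input n) l → (∀ j → j ≢ l → lookup x j ≡ lookup y j) →
           lookup y l ≡ not (lookup x l) → PAR y ≡ not (PAR x)
PAR-flip (a ∷ x) (b ∷ y) 0F agree flip = begin
  b xor PAR y      ≡⟨ cong₂ _xor_ flip (cong PAR (vec-ext {x = y} {x} λ j → sym (agree (sucF j) λ ()))) ⟩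
  not a xor PAR x  ≡⟨ not-distribˡ-xor a (PAR x) ⟨
  not (a xor PAR x) ∎
  where open ≡-Reasoning
PAR-flip (a ∷ x) (b ∷ y) (sucF l) agree flip = begin
  b xor PAR y        ≡⟨ cong₂ _xor_ (sym (agree 0F λ ())) (PAR-flip x y l (λ j j≢l → agree (sucF j) (j≢l ∘ Fin.suc-injective)) flip) ⟩
  a xor not (PAR x)  ≡⟨ not-distribʳ-xor a (PAR x) ⟨
  not (a xor PAR x)  ∎
  where open ≡-Reasoning

eval-cong : ∀ {n d} (T : DT n d) {b b′ : Fin n → Bool} → (∀ j → b j ≡ b′ j) → eval T b ≡ eval T b′
eval-cong (leaf o)      b≗b′ = refl
eval-cong (query j f t) {b} {b′} b≗b′ rewrite b≗b′ j with b′ j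
... | true  = eval-cong t b≗b′
... | false = eval-cong f b≗b′

eval-unvisited : ∀ {n d} (T : DT n d) {b b′ : Fin n → Bool} l → (∀ j → j ≢ l → b j ≡ b′ j) →
                 l ∉ visits T b → eval T b ≡ eval T b′
eval-unvisited (leaf o) l agree l∉ = refl
eval-unvisited (query j f t) {b} {b′} l agree l∉ =
  branch (b j) (b′ j) (agree j λ j≡l → l∉ (here (sym j≡l))) (l∉ ∘ there)
  where
  branch : ∀ c c′ → c ≡ c′ → l ∉ (if c then visits t b else visits f b) →
           (if c then eval t b else eval f b) ≡ (if c′ then eval t b′ else eval f b′)
  branch true  .true  refl l∉t = eval-unvisited t l agree l∉t
  branch false .false refl l∉f = eval-unvisited f l agree l∉f

lookup-injective : ∀ {A : Set} {n} (v : Vec A n) → Unique (toList v) →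
                   ∀ i k → lookup v i ≡ lookup v k → i ≡ k
lookup-injective (x ∷ v) u         0F       0F       _ = refl
lookup-injective (x ∷ v) (x∉ ∷ _)  0F       (sucF k) e = ⊥-elim (lookup⁺ (toList⁻ x∉) k e)
lookup-injective (x ∷ v) (x∉ ∷ _)  (sucF i) 0F       e = ⊥-elim (lookup⁺ (toList⁻ x∉) i (sym e))
lookup-injective (x ∷ v) (_ ∷ u)   (sucF i) (sucF k) e = cong sucF (lookup-injective v u i k e)

-- pigeonhole: a non-surjective f would punch out to an injection Fin (suc n) → Fin n
injective⇒surjective : ∀ {n} (f : Fin n → Fin n) → Injective _≡_ _≡_ f → ∀ j → ∃ λ i → f i ≡ j
injective⇒surjective {zero}  f f-inj ()
injective⇒surjective {suc n} f f-inj j with Fin.any? (λ i → f i ≟ᶠ j)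
... | yes hit = hit
... | no miss = ⊥-elim (ℕ.<-irrefl refl (Fin.injective⇒≤ g-inj))
  where
  f≢j : ∀ i → j ≢ f i
  f≢j i j≡fi = miss (i , sym j≡fi)
  g : Fin (suc n) → Fin n
  g i = punchOut (f≢j i)
  g-inj : Injective _≡_ _≡_ g
  g-inj {a} {b} ga≡gb = f-inj (Fin.punchOut-injective (f≢j a) (f≢j b) ga≡gb)

findPos-lookup : ∀ {n m} (v : Vec (Fin n) m) → Unique (toList v) → ∀ i → findPos v (lookup v i) ≡ just i
findPos-lookup (x ∷ v) _ 0F with x ≟ᶠ x
... | yes _   = refl
... | no x≢x = ⊥-elim (x≢x refl)
findPos-lookup (x ∷ v) (x∉ ∷ u) (sucF i) with x ≟ᶠ lookup v i
... | yes x≡vi = ⊥-elim (lookup⁺ (toList⁻ x∉) i x≡vi)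
... | no _ rewrite findPos-lookup v u i = refl

last-toList : ∀ {A : Set} {n} (v : Vec A (suc n)) → last (toList v) ≡ just (lookup v (fromℕ n))
last-toList {n = zero}  (x ∷ [])    = refl
last-toList {n = suc n} (x ∷ y ∷ v) = last-toList (y ∷ v)

toℕ≮⇒≡fromℕ : ∀ {n} (i : Fin (suc n)) → ¬ suc (toℕ i) ℕ.< suc n → i ≡ fromℕ n
toℕ≮⇒≡fromℕ {n} i i≮n = Fin.toℕ-injective (begin
  toℕ i      ≡⟨ ℕ.≤-antisym (ℕ.s≤s⁻¹ (Fin.toℕ<n i)) (ℕ.≮⇒≥ (i≮n ∘ s≤s)) ⟩
  n          ≡⟨ Fin.toℕ-fromℕ n ⟨
  toℕ (fromℕ n) ∎)
  where open ≡-Reasoning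

lastEntry : ∀ {n} → Perm (suc n) → Fin (suc n)
lastEntry {n} π = lookup (proj₁ π) (fromℕ n)

answers : ∀ {n} → Strategy n → Perm n → Bool → Input n
answers S π z = tabulate (bvec S π z)

module _ {n} (S : Strategy (suc n)) (π : Perm (suc n)) where

  private
    v = proj₁ π

  bvec-lookup : ∀ z i → bvec S π z (lookup v i) ≡ bAtPos S π z i
  bvec-lookup z i rewrite findPos-lookup v (proj₂ π) i = refl

  bvec-lastEntry : ∀ z → bvec S π z (lastEntry π) ≡ z
  bvec-lastEntry z rewrite bvec-lookup z (fromℕ n) with suc (toℕ (fromℕ n)) <? suc n
  ... | yes n<n = ⊥-elim (ℕ.<-irrefl (cong suc (Fin.toℕ-fromℕ n)) n<n)
  ... | no  _   = refl

  bAtPos-prefix : ∀ z i (lt : suc (toℕ i) ℕ.< suc n) → bAtPos S π z i ≡ F S (suc (toℕ i)) (s≤s z≤n) lt π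
  bAtPos-prefix z i lt with suc (toℕ i) <? suc n
  ... | yes lt′ = cong (λ p → F S (suc (toℕ i)) (s≤s z≤n) p π) (ℕ.<-irrelevant lt′ lt)
  ... | no  i≮n = ⊥-elim (i≮n lt)

  answeredAt : ∀ j → j ≢ lastEntry π →
    Σ (Fin (suc n)) λ i → Σ (suc (toℕ i) ℕ.< suc n) λ lt →
      lookup v i ≡ j × (∀ z → bvec S π z j ≡ F S (suc (toℕ i)) (s≤s z≤n) lt π)
  answeredAt j j≢last with injective⇒surjective (lookup v) (lookup-injective v (proj₂ π) _ _) j
  ... | i , refl with suc (toℕ i) <? suc n
  ...   | yes lt = i , lt , refl , λ z → trans (bvec-lookup z i) (bAtPos-prefix z i lt)
  ...   | no  i≮n = ⊥-elim (j≢last (cong (lookup v) (toℕ≮⇒≡fromℕ i i≮n)))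

  bvec-agree : ∀ z z′ j → j ≢ lastEntry π → bvec S π z j ≡ bvec S π z′ j
  bvec-agree z z′ j j≢last with answeredAt j j≢last
  ... | _ , _ , _ , answer = trans (answer z) (sym (answer z′))

  lookup-answers : ∀ z j → lookup (answers S π z) j ≡ bvec S π z j
  lookup-answers z = lookup∘tabulate (bvec S π z)

  PAR-answers : PAR (answers S π true) ≡ not (PAR (answers S π false))
  PAR-answers = PAR-flip (answers S π false) (answers S π true) (lastEntry π) agree flip
    where
    agree : ∀ j → j ≢ lastEntry π → lookup (answers S π false) j ≡ lookup (answers S π true) j
    agree j j≢last rewrite lookup-answers false j | lookup-answers true j = bvec-agree false true j j≢last
    flip : lookup (answers S π true) (lastEntry π) ≡ not (lookup (answers S π false) (lastEntry π))
    flip rewrite lookup-answers true (lastEntry π) | lookup-answers false (lastEntry π)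
               | bvec-lastEntry true | bvec-lastEntry false = refl

  searchSuccessful-lastEntry : ∀ z {d} (T : DT (suc n) d) →
    searchSuccessful S π z T ≡ does (DecMembership._∈?_ _≟ᶠ_ (lastEntry π) (visits T (bvec S π z)))
  searchSuccessful-lastEntry z T rewrite last-toList v = refl

correct-exclusive : ∀ e₀ e₁ P₀ P₁ → e₀ ≡ e₁ → P₁ ≡ not P₀ → does (e₀ ≟ᵇ P₀) ∧ does (e₁ ≟ᵇ P₁) ≡ false
correct-exclusive false .false false .true  refl refl = refl
correct-exclusive false .false true  .false refl refl = refl
correct-exclusive true  .true  false .true  refl refl = refl
correct-exclusive true  .true  true  .false refl refl = refl

module _ {n t} (S : Strategy (suc n)) (R : RandAlg (suc n) t) (π : Perm (suc n)) where

  correct : Bool → DT (suc n) t → Bool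
  correct z T = does (eval T (lookup (answers S π z)) ≟ᵇ PAR (answers S π z))

  searched-if-both-correct : ∀ z T → correct false T ∧ correct true T ≡ true →
                             searchSuccessful S π z T ≡ true
  searched-if-both-correct z T both rewrite searchSuccessful-lastEntry S π z T
    with DecMembership._∈?_ _≟ᶠ_ (lastEntry π) (visits T (bvec S π z))
  ... | yes _  = refl
  ... | no l∉ = contradiction (trans (sym both) (correct-exclusive _ _ _ _ same-output (PAR-answers S π))) λ ()
    where
    output≡ : ∀ z′ → eval T (lookup (answers S π z′)) ≡ eval T (bvec S π z)
    output≡ z′ = trans (eval-cong T (lookup-answers S π z′))
                       (sym (eval-unvisited T (lastEntry π) (bvec-agree S π z z′) l∉))
    same-output : eval T (lookup (answers S π false)) ≡ eval T (lookup (answers S π true))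
    same-output = trans (output≡ false) (sym (output≡ true))

  perm-success-≥-⅔ : ⅔ Q.≤ PrCorrect R (answers S π false) → ⅔ Q.≤ PrCorrect R (answers S π true) →
    ⅔ Q.≤ Σℚ (false ∷ true ∷ []) (λ z → Pr (support R) (searchSuccessful S π z))
  perm-success-≥-⅔ h₀ h₁ = subst (⅔ Q.≤_) (cong (λ x → Pr (support R) (searchSuccessful S π false) + x) (sym (+-identityʳ _)))
    (Pr-forced-≥-⅔ R (correct false) (correct true) (searchSuccessful S π false) (searchSuccessful S π true)
      (λ T both → cong₂ _∧_ (searched-if-both-correct false T both) (searched-if-both-correct true T both))
      h₀ h₁)

half-large : ∀ e c d → d ≤ c → 2 ^ suc e < d ℕ.+ c → 2 ^ e < c
half-large e c d d≤c large = ℕ.≰⇒> λ c≤2^e → ℕ.<⇒≱ large (begin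
  d ℕ.+ c          ≤⟨ ℕ.+-monoˡ-≤ c d≤c ⟩
  c ℕ.+ c          ≤⟨ ℕ.+-mono-≤ c≤2^e c≤2^e ⟩
  2 ^ e ℕ.+ 2 ^ e  ≡⟨ cong (2 ^ e ℕ.+_) (ℕ.+-identityʳ (2 ^ e)) ⟨
  2 ^ suc e        ∎)
  where open ℕ.≤-Reasoning

module _ {n : ℕ} where

  agreeing : Fin n → Bool → List (Input n) → List (Input n)
  agreeing j c = filter (λ y → lookup y j ≟ᵇ c)

  majority : Fin n → List (Input n) → Bool
  majority j L = length (agreeing j false L) ℕ.<ᵇ length (agreeing j true L)

  keepMajority : Fin n → List (Input n) → List (Input n)
  keepMajority j L = agreeing j (majority j L) L

  survivors : List (Input n) → (ℕ → Fin n) → ℕ → List (Input n)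
  survivors L f zero    = L
  survivors L f (suc k) = keepMajority (f k) (survivors L f k)

  length-agreeing : ∀ j L → length (agreeing j false L) ℕ.+ length (agreeing j true L) ≡ length L
  length-agreeing j [] = refl
  length-agreeing j (y ∷ L) with lookup y j
  ... | false = cong suc (length-agreeing j L)
  ... | true  = trans (ℕ.+-suc _ _) (cong suc (length-agreeing j L))

  keepMajority-large : ∀ e (j : Fin n) L → 2 ^ suc e < length L → 2 ^ e < length (keepMajority j L)
  keepMajority-large e j L large
    with majority j L | ℕ.<ᵇ-reflects-< (length (agreeing j false L)) (length (agreeing j true L))
  ... | true  | ofʸ f<t = half-large e _ _ (ℕ.<⇒≤ f<t)
      (subst (2 ^ suc e <_) (sym (length-agreeing j L)) large)
  ... | false | ofⁿ f≮t = half-large e _ _ (ℕ.≮⇒≥ f≮t)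
      (subst (2 ^ suc e <_) (trans (sym (length-agreeing j L)) (ℕ.+-comm (length (agreeing j false L)) _)) large)

  survivors-large : ∀ L (f : ℕ → Fin n) k e → 2 ^ (k ℕ.+ e) < length L → 2 ^ e < length (survivors L f k)
  survivors-large L f zero    e large = large
  survivors-large L f (suc k) e large =
    keepMajority-large e (f k) (survivors L f k)
      (survivors-large L f k (suc e) (subst (λ m → 2 ^ m < length L) (sym (ℕ.+-suc k e)) large))

  survivors-⊆ : ∀ L (f : ℕ → Fin n) k → survivors L f k ⊆ L
  survivors-⊆ L f zero    y∈ = y∈
  survivors-⊆ L f (suc k) y∈ = survivors-⊆ L f k (proj₁ (∈-filter⁻ _ y∈))

  survivors-unique : ∀ L (f : ℕ → Fin n) k → Unique L → Unique (survivors L f k)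
  survivors-unique L f zero    u = u
  survivors-unique L f (suc k) u = Unique.filter⁺ _ (survivors-unique L f k u)

  survivors-majority : ∀ L (f : ℕ → Fin n) k {y} → y ∈ survivors L f k →
                       ∀ i → i < k → lookup y (f i) ≡ majority (f i) (survivors L f i)
  survivors-majority L f (suc k) y∈ i i<1+k with ∈-filter⁻ _ y∈ | ℕ.m≤n⇒m<n∨m≡n (ℕ.s≤s⁻¹ i<1+k)
  ... | y∈′ , _      | inj₁ i<k  = survivors-majority L f k y∈′ i i<k
  ... | _   , yₖ≡maj | inj₂ refl = yₖ≡maj

  survivors-cong : ∀ L {f g : ℕ → Fin n} k → (∀ i → i < k → f i ≡ g i) → survivors L f k ≡ survivors L g k
  survivors-cong L zero    f≗g = refl
  survivors-cong L (suc k) f≗g =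
    cong₂ keepMajority (f≗g k ℕ.≤-refl) (survivors-cong L k (λ i i<k → f≗g i (ℕ.m<n⇒m<1+n i<k)))

Unique-Bool-image-∈ : ∀ {A : Set} (Y : Bool → A) {L : List A} → Unique L → 1 < length L →
                      (∀ {y} → y ∈ L → ∃ λ c → y ≡ Y c) → ∀ z → Y z ∈ L
Unique-Bool-image-∈ Y {y₁ ∷ y₂ ∷ _} ((y₁≢y₂ ∷ _) ∷ _) _ image
  with image (here refl) | image (there (here refl))
... | false , refl | true  , refl = λ { false → here refl ; true → there (here refl) }
... | true  , refl | false , refl = λ { false → there (here refl) ; true → here refl }
... | false , refl | false , refl = ⊥-elim (y₁≢y₂ refl)
... | true  , refl | true  , refl = ⊥-elim (y₁≢y₂ refl)
Unique-Bool-image-∈ Y {_ ∷ []} _ (s≤s ()) _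

-- π(k+1); the junk value 0F past the end is never consulted
entry : ∀ {n m} → Vec (Fin (suc n)) m → ℕ → Fin (suc n)
entry []      _       = 0F
entry (x ∷ v) zero    = x
entry (x ∷ v) (suc k) = entry v k

entry-lookup : ∀ {n m} (v : Vec (Fin (suc n)) m) i → entry v (toℕ i) ≡ lookup v i
entry-lookup (x ∷ v) 0F       = refl
entry-lookup (x ∷ v) (sucF i) = entry-lookup v i

entry-cong : ∀ {n m} (v w : Vec (Fin (suc n)) m) t → (∀ i → toℕ i < t → lookup v i ≡ lookup w i) →
             ∀ k → k < t → entry v k ≡ entry w k
entry-cong []      []      t       agree k       k<t       = refl
entry-cong (x ∷ v) (y ∷ w) (suc t) agree zero    _         = agree 0F (s≤s z≤n)
entry-cong (x ∷ v) (y ∷ w) (suc t) agree (suc k) (s≤s k<t) =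
  entry-cong v w t (λ i i<t → agree (sucF i) (s≤s i<t)) k k<t

bobAnswer : ∀ {n} → List (Input (suc n)) → (t : ℕ) → 1 ≤ t → t < suc n → Perm (suc n) → Bool
bobAnswer K (suc k) _ _ π = majority (entry (proj₁ π) k) (survivors K (entry (proj₁ π)) k)

bobAnswer-restricted : ∀ {n} (K : List (Input (suc n))) t (p : 1 ≤ t) (q : t < suc n) (π σ : Perm (suc n)) →
  (∀ i → toℕ i < t → lookup (proj₁ π) i ≡ lookup (proj₁ σ) i) → bobAnswer K t p q π ≡ bobAnswer K t p q σ
bobAnswer-restricted K (suc k) _ _ π σ agree =
  cong₂ majority (same k ℕ.≤-refl) (survivors-cong K k (λ i i<k → same i (ℕ.m<n⇒m<1+n i<k)))
  where
  same : ∀ i → i < suc k → entry (proj₁ π) i ≡ entry (proj₁ σ) i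
  same = entry-cong (proj₁ π) (proj₁ σ) (suc k) agree

bob : ∀ {n} → List (Input (suc n)) → Strategy (suc n)
bob K = record { F = bobAnswer K ; restricted = bobAnswer-restricted K }

module _ {n} (K : List (Input (suc n))) (π : Perm (suc n)) where

  private
    v = proj₁ π

  survivor-answers : ∀ {y} → y ∈ survivors K (entry v) n → y ≡ answers (bob K) π (lookup y (lastEntry π))
  survivor-answers {y} y∈ = vec-ext λ j → trans (lookup-y j) (sym (lookup-answers (bob K) π _ j))
    where
    lookup-y : ∀ j → lookup y j ≡ bvec (bob K) π (lookup y (lastEntry π)) j
    lookup-y j with j ≟ᶠ lastEntry π
    ... | yes refl = sym (bvec-lastEntry (bob K) π _)
    ... | no j≢last with answeredAt (bob K) π j j≢last
    ...   | i , lt , refl , answer = begin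
      lookup y (lookup v i)                        ≡⟨ cong (lookup y) (entry-lookup v i) ⟨
      lookup y (entry v (toℕ i))                   ≡⟨ survivors-majority K (entry v) n y∈ (toℕ i) (ℕ.s≤s⁻¹ lt) ⟩
      bobAnswer K (suc (toℕ i)) (s≤s z≤n) lt π     ≡⟨ answer _ ⟨
      bvec (bob K) π (lookup y (lastEntry π)) (lookup v i) ∎
      where open ≡-Reasoning

  answers-∈ : Unique K → 2 ^ n < length K → ∀ z → answers (bob K) π z ∈ K
  answers-∈ unique large z = survivors-⊆ K (entry v) n
    (Unique-Bool-image-∈ (answers (bob K) π) (survivors-unique K (entry v) n unique)
      (survivors-large K (entry v) n 0 (subst (λ m → 2 ^ m < length K) (sym (ℕ.+-identityʳ n)) large))
      (λ y∈ → _ , survivor-answers y∈) z)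

⅓*2k≡⅔*k : ∀ k → ⅓ * ℕtoℚ (2 ℕ.* k) ≡ ⅔ * ℕtoℚ k
⅓*2k≡⅔*k k = begin
  ⅓ * ℕtoℚ (k ℕ.+ (k ℕ.+ 0))   ≡⟨ cong (λ m → ⅓ * ℕtoℚ (k ℕ.+ m)) (ℕ.+-identityʳ k) ⟩
  ⅓ * ℕtoℚ (k ℕ.+ k)           ≡⟨ cong (⅓ *_) (ℕtoℚ-+ k k) ⟩
  ⅓ * (ℕtoℚ k + ℕtoℚ k)        ≡⟨ solve 2 (λ r x → r :* (x :+ x) := (r :+ r) :* x) refl ⅓ (ℕtoℚ k) ⟩
  (⅓ + ⅓) * ℕtoℚ k             ≡⟨⟩
  ⅔ * ℕtoℚ k                   ∎
  where
  open ≡-Reasoning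
  open +-*-Solver

theorem2 : (n t : ℕ) → 1 < n → 0 < t → t ≤ n →
    (R : RandAlg n t) →
    (K : List (Input n)) → Unique K → 2 ^ (n ∸ 1) < length K →
    (∀ y → y ∈ K → (+ 2) / 3 Q.≤ PrCorrect R y) →
    Σ (Strategy n) (λ S →
      ((+ 1) / 3) * ℕtoℚ (2 Data.Nat.* length (allPerms n)) Q.≤ successMass S R)
theorem2 zero    t () _ _ R K unique large accurate
theorem2 (suc n) t _  _ _ R K unique large accurate = bob K , (begin
  ⅓ * ℕtoℚ (2 ℕ.* length (allPerms (suc n)))   ≡⟨ ⅓*2k≡⅔*k (length (allPerms (suc n))) ⟩
  ⅔ * ℕtoℚ (length (allPerms (suc n)))         ≤⟨ *-length≤Σℚ (allPerms (suc n)) ⅔ success ⟩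
  successMass (bob K) R                        ∎)
  where
  open ≤-Reasoning
  success : ∀ π → ⅔ Q.≤ Σℚ (false ∷ true ∷ []) (λ z → Pr (support R) (searchSuccessful (bob K) π z))
  success π = perm-success-≥-⅔ (bob K) R π
    (accurate _ (answers-∈ K π unique large false)) (accurate _ (answers-∈ K π unique large true))
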